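{- Let $m,n\ge 0$, $H\subseteq\{0,\dots,m-1\}$, $V\subseteq\{1,\dots,n\}$, and $s=\sum_{h\in H}h+\sum_{v\in V}v$. Then $$\sum_{p\in\mathcal P_{m,n}} q^{\mathrm{CINDEX}^{(H,V)}(p)}=q^{s}\begin{bmatrix} m+n\\ m\end{bmatrix}_q=q^s\sum_{p\in\mathcal P_{m,n}}q^{\mathrm{CINDEX}(p)};$$ that is, the scrambled statistic $\mathrm{CINDEX}^{(H,V)}$ is equidistributed with the unscrambled $\mathrm{CINDEX}$ (and hence with $\mathrm{AREA}$, the number of grid squares below the path) up to a shift by $s$.
   Context: The grid $G_{m,n}$ has nodes $(i,j)$, $0\le i\le m$ (row, downward), $0\le j\le n$ (column, rightward). $\mathcal P_{m,n}$ is the set of lattice paths from $(0,0)$ to $(m,n)$ with unit down and right steps. A true corner is a node where a right step is immediately followed by a down step. Each $h\in H$ marks the node of the path on row $h$ from which it steps down to row $h+1$; each $v\in V$ marks the node reached by the path's $v$-th right step. $\mathrm{CINDEX}^{(H,V)}(p)$ is the sum of $i+j$ over the set of nodes $(i,j)$ that are true corners or marked (each node counted once); $\mathrm{CINDEX}(p)$ is the same with $H=V=\varnothing$. $\begin{bmatrix} a\\ b\end{bmatrix}_q$ is the Gaussian polynomial. -}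

module Defs where

open import Data.Nat using (ℕ; zero; suc; _+_; _∸_; _≤ᵇ_; _≡ᵇ_)
open import Data.Bool using (Bool; true; false; if_then_else_; _∧_; _∨_)
open import Data.List using (List; []; _∷_; map; _++_; foldr)
open import Data.Vec using (Vec; []; _∷_)
open import Data.Fin.Subset using (Subset)
open import Relation.Binary.PropositionalEquality using (_≡_)

-- Polynomials in q with natural coefficients, as coefficient functions
-- (p k = coefficient of q^k).  Equality is coefficientwise.

Poly : Set
Poly = ℕ → ℕ

_≗ₚ_ : Poly → Poly → Set
p ≗ₚ r = ∀ k → p k ≡ r k

0ₚ : Poly
0ₚ _ = 0

_+ₚ_ : Poly → Poly → Poly
(p +ₚ r) k = p k + r k

mono : ℕ → Poly
mono e k = if e ≡ᵇ k then 1 else 0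

shift : ℕ → Poly → Poly
shift s p k = if s ≤ᵇ k then p (k ∸ s) else 0

gauss : ℕ → ℕ → Poly
gauss a       zero    = mono 0
gauss zero    (suc b) = 0ₚ
gauss (suc a) (suc b) = gauss a b +ₚ shift (suc b) (gauss a (suc b))

-- Lattice paths: sequences of unit steps R (right, j+1) and D (down, i+1).

data Step : Set where
  R D : Step

Path : Set
Path = List Step

paths : ℕ → ℕ → List Path
paths zero    zero    = [] ∷ []
paths (suc m) zero    = map (D ∷_) (paths m zero)
paths zero    (suc n) = map (R ∷_) (paths zero n)
paths (suc m) (suc n) = map (D ∷_) (paths m (suc n)) ++ map (R ∷_) (paths (suc m) n)

genPoly : ℕ → ℕ → (Path → ℕ) → Poly
genPoly m n stat = foldr (λ p acc → mono (stat p) +ₚ acc) 0ₚ (paths m n)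

isR : Step → Bool
isR R = true
isR D = false

isD : Step → Bool
isD D = true
isD R = false

-- walk the path: current node (i,j), whether the step into it was R,
-- and the remaining steps.  Node (i,j) contributes i+j iff it is
--   a true corner (entered by R, left by D), or
--   marked by H (left by D and i ∈ H), or
--   marked by V (entered by R and j ∈ V).
nextIsD : Path → Bool
nextIsD []      = false
nextIsD (s ∷ _) = isD s

here : (ℕ → Bool) → (ℕ → Bool) → Bool → ℕ → ℕ → Path → ℕ
here inH inV prevR i j steps =
  if (prevR ∧ nextIsD steps) ∨ (nextIsD steps ∧ inH i) ∨ (prevR ∧ inV j)
  then i + j else 0

walk : (ℕ → Bool) → (ℕ → Bool) → Bool → ℕ → ℕ → Path → ℕ
walk inH inV prevR i j []       = here inH inV prevR i j []
walk inH inV prevR i j (R ∷ ss) =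
  here inH inV prevR i j (R ∷ ss) + walk inH inV true i (suc j) ss
walk inH inV prevR i j (D ∷ ss) =
  here inH inV prevR i j (D ∷ ss) + walk inH inV false (suc i) j ss

cindexWith : (ℕ → Bool) → (ℕ → Bool) → Path → ℕ
cindexWith inH inV p = walk inH inV false 0 0 p

memb : ∀ {m} → Subset m → ℕ → Bool
memb []       _       = false
memb (b ∷ bs) zero    = b
memb (b ∷ bs) (suc k) = memb bs k

-- H ⊆ {0,…,m-1} : index h ↔ row h
inRows : ∀ {m} → Subset m → ℕ → Bool
inRows H h = memb H h

-- V ⊆ {1,…,n} : index v-1 ↔ right step v
inCols : ∀ {n} → Subset n → ℕ → Bool
inCols V zero    = false
inCols V (suc v) = memb V v

CINDEXHV : ∀ {m n} → Subset m → Subset n → Path → ℕ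
CINDEXHV H V = cindexWith (inRows H) (inCols V)

CINDEX : Path → ℕ
CINDEX = cindexWith (λ _ → false) (λ _ → false)

-- Σ_{x ∈ S} (x + off), with S encoded with index 0 ↦ element off
sumFrom : ∀ {k} → ℕ → Subset k → ℕ
sumFrom off []       = 0
sumFrom off (b ∷ bs) = (if b then off else 0) + sumFrom (suc off) bs

shiftSum : ∀ {m n} → Subset m → Subset n → ℕ
shiftSum H V = sumFrom 0 H + sumFrom 1 V

module Submission where

-- Score the last node of a path as if the path continued with a step s, and let
-- A_s(m,n) be the resulting generating function over P_{m,n}; the theorem is about A_R.
-- Splitting paths by their last step expresses A_s(m+1,n+1) through A_D(m,n+1) and
-- A_R(m+1,n), shifted by the scores of the corner node (m+1,n+1). The candidate
-- q^(σH m + σV n) [m+n, m]_q for A_R, with a companion for A_D, obeys the same recursion: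
-- depending on whether row m+1 and column n+1 are marked, it reduces to one of the two
-- q-Pascal rules
--   [m+n+2, m+1] = [m+n+1, m] + q^(m+1) [m+n+1, m+1] = q^(n+1) [m+n+1, m] + [m+n+1, m+1].
-- Taking H = V = ∅ gives the unscrambled statistic.

open import Defs
open import Data.Bool using (Bool; true; false; if_then_else_; _∨_)
open import Data.Fin.Subset using (Subset)
open import Data.List using (List; []; _∷_; map; _++_; _∷ʳ_; foldr; foldl)
open import Data.List.Properties using (foldr-map; foldl-∷ʳ)
open import Data.Nat using (ℕ; zero; suc; _+_; _<_; s≤s)
open import Data.Nat.Properties
  using (+-commutativeSemigroup; +-comm; +-suc; +-identityʳ; +-assoc; n<1+n; m<n⇒m<1+n)
open import Data.Product using (_×_; _,_)
open import Data.Vec using ([]; _∷_)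
open import Function using (_∘_)
open import Level using (0ℓ)
open import Relation.Binary.Bundles using (Setoid)
open import Relation.Binary.PropositionalEquality as ≡ using (_≡_; refl; cong; cong₂; subst)
open import Algebra.Properties.CommutativeSemigroup +-commutativeSemigroup
  using () renaming (interchange to +-interchange; x∙yz≈y∙xz to +-left-comm; xy∙z≈xz∙y to +-right-comm)
import Algebra.Construct.Pointwise ℕ as Pointwise

-- Polynomial identities

polySetoid : Setoid 0ℓ 0ℓ
polySetoid = record
  { Carrier       = Poly
  ; _≈_           = _≗ₚ_
  ; isEquivalence = Pointwise.isEquivalence ≡.isEquivalence
  }

open Setoid polySetoid using () renaming (refl to ≗ₚ-refl; sym to ≗ₚ-sym; trans to ≗ₚ-trans)
open import Relation.Binary.Reasoning.Setoid polySetoid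

+ₚ-cong : ∀ {p p′ r r′} → p ≗ₚ p′ → r ≗ₚ r′ → (p +ₚ r) ≗ₚ (p′ +ₚ r′)
+ₚ-cong e e′ k = cong₂ _+_ (e k) (e′ k)

+ₚ-congˡ : ∀ p {r r′} → r ≗ₚ r′ → (p +ₚ r) ≗ₚ (p +ₚ r′)
+ₚ-congˡ p = +ₚ-cong (≗ₚ-refl {p})

+ₚ-congʳ : ∀ r {p p′} → p ≗ₚ p′ → (p +ₚ r) ≗ₚ (p′ +ₚ r)
+ₚ-congʳ r e = +ₚ-cong e (≗ₚ-refl {r})

+ₚ-assoc : ∀ p q r → ((p +ₚ q) +ₚ r) ≗ₚ (p +ₚ (q +ₚ r))
+ₚ-assoc p q r k = +-assoc (p k) (q k) (r k)

+ₚ-comm : ∀ p q → (p +ₚ q) ≗ₚ (q +ₚ p)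
+ₚ-comm p q k = +-comm (p k) (q k)

+ₚ-left-comm : ∀ p q r → (p +ₚ (q +ₚ r)) ≗ₚ (q +ₚ (p +ₚ r))
+ₚ-left-comm p q r k = +-left-comm (p k) (q k) (r k)

+ₚ-right-comm : ∀ p q r → ((p +ₚ q) +ₚ r) ≗ₚ ((p +ₚ r) +ₚ q)
+ₚ-right-comm p q r k = +-right-comm (p k) (q k) (r k)

+ₚ-interchange : ∀ p q r s → ((p +ₚ q) +ₚ (r +ₚ s)) ≗ₚ ((p +ₚ r) +ₚ (q +ₚ s))
+ₚ-interchange p q r s k = +-interchange (p k) (q k) (r k) (s k)

shift-suc : ∀ a p k → shift (suc a) p (suc k) ≡ shift a p k
shift-suc zero    p k = refl
shift-suc (suc a) p k = refl

shift-cong : ∀ a {p r} → p ≗ₚ r → shift a p ≗ₚ shift a r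
shift-cong zero    e k       = e k
shift-cong (suc a) e zero    = refl
shift-cong (suc a) {p} {r} e (suc k) =
  ≡.trans (shift-suc a p k) (≡.trans (shift-cong a e k) (≡.sym (shift-suc a r k)))

shift-0ₚ : ∀ a → shift a 0ₚ ≗ₚ 0ₚ
shift-0ₚ zero    k       = refl
shift-0ₚ (suc a) zero    = refl
shift-0ₚ (suc a) (suc k) = ≡.trans (shift-suc a 0ₚ k) (shift-0ₚ a k)

shift-+ₚ : ∀ a p r → shift a (p +ₚ r) ≗ₚ (shift a p +ₚ shift a r)
shift-+ₚ zero    p r k       = refl
shift-+ₚ (suc a) p r zero    = refl
shift-+ₚ (suc a) p r (suc k) =
  ≡.trans (shift-suc a (p +ₚ r) k)
    (≡.trans (shift-+ₚ a p r k) (≡.sym (cong₂ _+_ (shift-suc a p k) (shift-suc a r k))))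

shift-shift : ∀ a b p → shift a (shift b p) ≗ₚ shift (a + b) p
shift-shift zero    b p k       = refl
shift-shift (suc a) b p zero    = refl
shift-shift (suc a) b p (suc k) =
  ≡.trans (shift-suc a (shift b p) k)
    (≡.trans (shift-shift a b p k) (≡.sym (shift-suc (a + b) p k)))

shift-comm : ∀ a b p → shift a (shift b p) ≗ₚ shift b (shift a p)
shift-comm a b p = begin
  shift a (shift b p)  ≈⟨ shift-shift a b p ⟩
  shift (a + b) p      ≡⟨ cong (λ c → shift c p) (+-comm a b) ⟩
  shift (b + a) p      ≈⟨ ≗ₚ-sym (shift-shift b a p) ⟩
  shift b (shift a p)  ∎

shift-cong₂ : ∀ {a b p r} → a ≡ b → p ≗ₚ r → shift a p ≗ₚ shift b r
shift-cong₂ {a} refl = shift-cong a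

shift-inward : ∀ c a b p → shift c (shift a (shift b p)) ≗ₚ shift a (shift b (shift c p))
shift-inward c a b p = ≗ₚ-trans (shift-comm c a (shift b p)) (shift-cong a (shift-comm c b p))

shift₂-+ₚ : ∀ a b c d p r →
  (shift c (shift a (shift b p)) +ₚ shift d (shift a (shift b r)))
    ≗ₚ shift a (shift b (shift c p +ₚ shift d r))
shift₂-+ₚ a b c d p r = begin
  shift c (shift a (shift b p)) +ₚ shift d (shift a (shift b r))
    ≈⟨ +ₚ-cong (shift-inward c a b p) (shift-inward d a b r) ⟩
  shift a (shift b (shift c p)) +ₚ shift a (shift b (shift d r))
    ≈⟨ ≗ₚ-sym (shift-+ₚ a (shift b (shift c p)) (shift b (shift d r))) ⟩
  shift a (shift b (shift c p) +ₚ shift b (shift d r))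
    ≈⟨ shift-cong a (≗ₚ-sym (shift-+ₚ b (shift c p) (shift d r))) ⟩
  shift a (shift b (shift c p +ₚ shift d r))
    ∎

shift-mono : ∀ a b → shift a (mono b) ≗ₚ mono (a + b)
shift-mono zero    b k       = refl
shift-mono (suc a) b zero    = refl
shift-mono (suc a) b (suc k) = ≡.trans (shift-suc a (mono b) k) (shift-mono a b k)

-- Gaussian polynomials

gauss-above : ∀ {a b} → a < b → gauss a b ≗ₚ 0ₚ
gauss-above {zero}  {suc b} _         k = refl
gauss-above {suc a} {suc b} (s≤s a<b) k =
  cong₂ _+_ (gauss-above a<b k)
    (≡.trans (shift-cong (suc b) (gauss-above (m<n⇒m<1+n a<b)) k) (shift-0ₚ (suc b) k))

gauss-diag : ∀ a → gauss a a ≗ₚ mono 0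
gauss-diag zero    k = refl
gauss-diag (suc a) k =
  ≡.trans (cong₂ _+_ (gauss-diag a k)
            (≡.trans (shift-cong (suc a) (gauss-above (n<1+n a)) k) (shift-0ₚ (suc a) k)))
          (+-identityʳ _)

gaussBox : ℕ → ℕ → Poly
gaussBox m n = gauss (m + n) m

gaussBox-zeroʳ : ∀ m → gaussBox m 0 ≗ₚ mono 0
gaussBox-zeroʳ m = subst (λ a → gauss a m ≗ₚ mono 0) (≡.sym (+-identityʳ m)) (gauss-diag m)

gaussBox-zeroʳ-const : ∀ m m′ → gaussBox m 0 ≗ₚ gaussBox m′ 0
gaussBox-zeroʳ-const m m′ = begin
  gaussBox m 0   ≈⟨ gaussBox-zeroʳ m ⟩
  mono 0         ≈⟨ ≗ₚ-sym (gaussBox-zeroʳ m′) ⟩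
  gaussBox m′ 0  ∎

gaussBox-pascal : ∀ m n →
  gaussBox (suc m) (suc n) ≗ₚ (gaussBox m (suc n) +ₚ shift (suc m) (gaussBox (suc m) n))
gaussBox-pascal m n k rewrite +-suc m n = refl

gaussBox-pascal′ : ∀ m n →
  gaussBox (suc m) (suc n) ≗ₚ (shift (suc n) (gaussBox m (suc n)) +ₚ gaussBox (suc m) n)
gaussBox-pascal′ zero zero = begin
  gaussBox 1 1                            ≈⟨ gaussBox-pascal 0 0 ⟩
  gaussBox 0 1 +ₚ shift 1 (gaussBox 1 0)  ≈⟨ +ₚ-comm (gaussBox 0 1) (shift 1 (gaussBox 1 0)) ⟩
  shift 1 (gaussBox 1 0) +ₚ gaussBox 0 1  ≈⟨ +ₚ-cong (shift-cong 1 (gaussBox-zeroʳ 1)) (≗ₚ-sym (gaussBox-zeroʳ 1)) ⟩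
  shift 1 (gaussBox 0 1) +ₚ gaussBox 1 0  ∎
gaussBox-pascal′ zero (suc n) = begin
  gaussBox 1 (2 + n)
    ≈⟨ gaussBox-pascal 0 (suc n) ⟩
  one +ₚ shift 1 (gaussBox 1 (suc n))
    ≈⟨ +ₚ-congˡ one (shift-cong 1 (gaussBox-pascal′ 0 n)) ⟩
  one +ₚ shift 1 (shift (suc n) one +ₚ gaussBox 1 n)
    ≈⟨ +ₚ-congˡ one (shift-+ₚ 1 (shift (suc n) one) (gaussBox 1 n)) ⟩
  one +ₚ (shift 1 (shift (suc n) one) +ₚ shift 1 (gaussBox 1 n))
    ≈⟨ +ₚ-left-comm one (shift 1 (shift (suc n) one)) (shift 1 (gaussBox 1 n)) ⟩
  shift 1 (shift (suc n) one) +ₚ (one +ₚ shift 1 (gaussBox 1 n))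
    ≈⟨ +ₚ-cong (shift-shift 1 (suc n) one) (≗ₚ-sym (gaussBox-pascal 0 n)) ⟩
  shift (2 + n) one +ₚ gaussBox 1 (suc n)
    ∎
  where one = mono 0
gaussBox-pascal′ (suc m) zero = begin
  gaussBox (2 + m) 1
    ≈⟨ gaussBox-pascal (suc m) 0 ⟩
  gaussBox (suc m) 1 +ₚ shift (2 + m) (gaussBox (2 + m) 0)
    ≈⟨ +ₚ-cong (gaussBox-pascal′ m 0) (shift-cong (2 + m) (gaussBox-zeroʳ (2 + m))) ⟩
  (shift 1 (gaussBox m 1) +ₚ gaussBox (suc m) 0) +ₚ shift (2 + m) one
    ≈⟨ +ₚ-right-comm (shift 1 (gaussBox m 1)) (gaussBox (suc m) 0) (shift (2 + m) one) ⟩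
  (shift 1 (gaussBox m 1) +ₚ shift (2 + m) one) +ₚ gaussBox (suc m) 0
    ≈⟨ +ₚ-cong (≗ₚ-sym upper) (gaussBox-zeroʳ-const (suc m) (2 + m)) ⟩
  shift 1 (gaussBox (suc m) 1) +ₚ gaussBox (2 + m) 0
    ∎
  where
  one = mono 0
  upper : shift 1 (gaussBox (suc m) 1) ≗ₚ (shift 1 (gaussBox m 1) +ₚ shift (2 + m) one)
  upper = begin
    shift 1 (gaussBox (suc m) 1)
      ≈⟨ shift-cong 1 (gaussBox-pascal m 0) ⟩
    shift 1 (gaussBox m 1 +ₚ shift (suc m) (gaussBox (suc m) 0))
      ≈⟨ shift-+ₚ 1 (gaussBox m 1) (shift (suc m) (gaussBox (suc m) 0)) ⟩
    shift 1 (gaussBox m 1) +ₚ shift 1 (shift (suc m) (gaussBox (suc m) 0))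
      ≈⟨ +ₚ-congˡ (shift 1 (gaussBox m 1))
           (≗ₚ-trans (shift-shift 1 (suc m) (gaussBox (suc m) 0)) (shift-cong (2 + m) (gaussBox-zeroʳ (suc m)))) ⟩
    shift 1 (gaussBox m 1) +ₚ shift (2 + m) one
      ∎
gaussBox-pascal′ (suc m) (suc n) = begin
  gaussBox (suc x) (suc y)
    ≈⟨ gaussBox-pascal x y ⟩
  gaussBox x (suc y) +ₚ shift (suc x) (gaussBox (suc x) y)
    ≈⟨ +ₚ-cong (gaussBox-pascal′ m (suc n)) (shift-cong (suc x) (gaussBox-pascal′ (suc m) n)) ⟩
  (a +ₚ b) +ₚ shift (suc x) (shift y b +ₚ d)
    ≈⟨ +ₚ-congˡ (a +ₚ b) (shift-+ₚ (suc x) (shift y b) d) ⟩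
  (a +ₚ b) +ₚ (shift (suc x) (shift y b) +ₚ shift (suc x) d)
    ≈⟨ +ₚ-congˡ (a +ₚ b) (+ₚ-congʳ (shift (suc x) d) corner) ⟩
  (a +ₚ b) +ₚ (shift (suc y) (shift x b) +ₚ shift (suc x) d)
    ≈⟨ +ₚ-interchange a b (shift (suc y) (shift x b)) (shift (suc x) d) ⟩
  (a +ₚ shift (suc y) (shift x b)) +ₚ (b +ₚ shift (suc x) d)
    ≈⟨ +ₚ-cong (≗ₚ-sym (shift-+ₚ (suc y) (gaussBox m (suc y)) (shift x b))) (≗ₚ-sym (gaussBox-pascal x n)) ⟩
  shift (suc y) (gaussBox m (suc y) +ₚ shift x b) +ₚ gaussBox (suc x) y
    ≈⟨ +ₚ-congʳ (gaussBox (suc x) y) (shift-cong (suc y) (≗ₚ-sym (gaussBox-pascal m y))) ⟩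
  shift (suc y) (gaussBox x (suc y)) +ₚ gaussBox (suc x) y
    ∎
  where
  x = suc m
  y = suc n
  a = shift (suc y) (gaussBox m (suc y))
  b = gaussBox x y
  d = gaussBox (suc x) n
  corner : shift (suc x) (shift y b) ≗ₚ shift (suc y) (shift x b)
  corner = begin
    shift (suc x) (shift y b)  ≈⟨ shift-shift (suc x) y b ⟩
    shift (suc (x + y)) b      ≡⟨ cong (λ e → shift (suc e) b) (+-comm x y) ⟩
    shift (suc (y + x)) b      ≈⟨ ≗ₚ-sym (shift-shift (suc y) x b) ⟩
    shift (suc y) (shift x b)  ∎

gaussBox-pascal-shifted : ∀ m n →
  (shift (suc n) (gaussBox m (suc n)) +ₚ shift (suc m + suc n) (gaussBox (suc m) n))
    ≗ₚ shift (suc n) (gaussBox (suc m) (suc n))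
gaussBox-pascal-shifted m n = begin
  shift (suc n) (gaussBox m (suc n)) +ₚ shift (suc m + suc n) (gaussBox (suc m) n)
    ≈⟨ +ₚ-congˡ (shift (suc n) (gaussBox m (suc n))) corner ⟩
  shift (suc n) (gaussBox m (suc n)) +ₚ shift (suc n) (shift (suc m) (gaussBox (suc m) n))
    ≈⟨ ≗ₚ-sym (shift-+ₚ (suc n) (gaussBox m (suc n)) (shift (suc m) (gaussBox (suc m) n))) ⟩
  shift (suc n) (gaussBox m (suc n) +ₚ shift (suc m) (gaussBox (suc m) n))
    ≈⟨ shift-cong (suc n) (≗ₚ-sym (gaussBox-pascal m n)) ⟩
  shift (suc n) (gaussBox (suc m) (suc n))
    ∎
  where
  corner : shift (suc m + suc n) (gaussBox (suc m) n) ≗ₚ shift (suc n) (shift (suc m) (gaussBox (suc m) n))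
  corner = begin
    shift (suc m + suc n) (gaussBox (suc m) n)        ≡⟨ cong (λ e → shift e (gaussBox (suc m) n)) (+-comm (suc m) (suc n)) ⟩
    shift (suc n + suc m) (gaussBox (suc m) n)        ≈⟨ ≗ₚ-sym (shift-shift (suc n) (suc m) (gaussBox (suc m) n)) ⟩
    shift (suc n) (shift (suc m) (gaussBox (suc m) n)) ∎

-- Sums over lattice paths

sumOver : {A : Set} → List A → (A → Poly) → Poly
sumOver xs F = foldr (λ x acc → F x +ₚ acc) 0ₚ xs

sumOver-map : ∀ {A B : Set} (g : A → B) xs F → sumOver (map g xs) F ≡ sumOver xs (F ∘ g)
sumOver-map g xs F = foldr-map (λ x acc → F x +ₚ acc) g 0ₚ xs

sumOver-++ : ∀ {A : Set} (xs ys : List A) F →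
  sumOver (xs ++ ys) F ≗ₚ (sumOver xs F +ₚ sumOver ys F)
sumOver-++ []       ys F = ≗ₚ-refl
sumOver-++ (x ∷ xs) ys F = begin
  F x +ₚ sumOver (xs ++ ys) F               ≈⟨ +ₚ-congˡ (F x) (sumOver-++ xs ys F) ⟩
  F x +ₚ (sumOver xs F +ₚ sumOver ys F)     ≈⟨ ≗ₚ-sym (+ₚ-assoc (F x) (sumOver xs F) (sumOver ys F)) ⟩
  (F x +ₚ sumOver xs F) +ₚ sumOver ys F     ∎

sumOver-shift : ∀ {A : Set} a (xs : List A) F → sumOver xs (shift a ∘ F) ≗ₚ shift a (sumOver xs F)
sumOver-shift a []       F = ≗ₚ-sym (shift-0ₚ a)
sumOver-shift a (x ∷ xs) F = begin
  shift a (F x) +ₚ sumOver xs (shift a ∘ F)  ≈⟨ +ₚ-congˡ (shift a (F x)) (sumOver-shift a xs F) ⟩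
  shift a (F x) +ₚ shift a (sumOver xs F)    ≈⟨ ≗ₚ-sym (shift-+ₚ a (F x) (sumOver xs F)) ⟩
  shift a (F x +ₚ sumOver xs F)              ∎

pathSum : ℕ → ℕ → (Path → Poly) → Poly
pathSum m n = sumOver (paths m n)

pathSum-D∷ : ∀ m F → pathSum (suc m) 0 F ≡ pathSum m 0 (F ∘ (D ∷_))
pathSum-D∷ m = sumOver-map (D ∷_) (paths m 0)

pathSum-R∷ : ∀ n F → pathSum 0 (suc n) F ≡ pathSum 0 n (F ∘ (R ∷_))
pathSum-R∷ n = sumOver-map (R ∷_) (paths 0 n)

pathSum-∷ : ∀ m n F →
  pathSum (suc m) (suc n) F ≗ₚ (pathSum m (suc n) (F ∘ (D ∷_)) +ₚ pathSum (suc m) n (F ∘ (R ∷_)))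
pathSum-∷ m n F = begin
  pathSum (suc m) (suc n) F
    ≈⟨ sumOver-++ (map (D ∷_) (paths m (suc n))) (map (R ∷_) (paths (suc m) n)) F ⟩
  sumOver (map (D ∷_) (paths m (suc n))) F +ₚ sumOver (map (R ∷_) (paths (suc m) n)) F
    ≡⟨ cong₂ _+ₚ_ (sumOver-map (D ∷_) (paths m (suc n)) F) (sumOver-map (R ∷_) (paths (suc m) n) F) ⟩
  pathSum m (suc n) (F ∘ (D ∷_)) +ₚ pathSum (suc m) n (F ∘ (R ∷_))
    ∎

pathSum-∷ʳD : ∀ m F → pathSum (suc m) 0 F ≗ₚ pathSum m 0 (F ∘ (_∷ʳ D))
pathSum-∷ʳD zero    F = ≗ₚ-refl
pathSum-∷ʳD (suc m) F = begin
  pathSum (2 + m) 0 F                  ≡⟨ pathSum-D∷ (suc m) F ⟩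
  pathSum (suc m) 0 (F ∘ (D ∷_))       ≈⟨ pathSum-∷ʳD m (F ∘ (D ∷_)) ⟩
  pathSum m 0 (F ∘ (_∷ʳ D) ∘ (D ∷_))   ≡⟨ ≡.sym (pathSum-D∷ m (F ∘ (_∷ʳ D))) ⟩
  pathSum (suc m) 0 (F ∘ (_∷ʳ D))      ∎

pathSum-∷ʳR : ∀ n F → pathSum 0 (suc n) F ≗ₚ pathSum 0 n (F ∘ (_∷ʳ R))
pathSum-∷ʳR zero    F = ≗ₚ-refl
pathSum-∷ʳR (suc n) F = begin
  pathSum 0 (2 + n) F                  ≡⟨ pathSum-R∷ (suc n) F ⟩
  pathSum 0 (suc n) (F ∘ (R ∷_))       ≈⟨ pathSum-∷ʳR n (F ∘ (R ∷_)) ⟩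
  pathSum 0 n (F ∘ (_∷ʳ R) ∘ (R ∷_))   ≡⟨ ≡.sym (pathSum-R∷ n (F ∘ (_∷ʳ R))) ⟩
  pathSum 0 (suc n) (F ∘ (_∷ʳ R))      ∎

pathSum-∷ʳ : ∀ m n F →
  pathSum (suc m) (suc n) F ≗ₚ (pathSum m (suc n) (F ∘ (_∷ʳ D)) +ₚ pathSum (suc m) n (F ∘ (_∷ʳ R)))
pathSum-∷ʳ zero zero F =
  ≗ₚ-trans (pathSum-∷ 0 0 F) (+ₚ-comm (pathSum 0 1 (F ∘ (D ∷_))) (pathSum 1 0 (F ∘ (R ∷_))))
pathSum-∷ʳ (suc m) zero F = begin
  pathSum (2 + m) 1 F
    ≈⟨ pathSum-∷ (suc m) 0 F ⟩
  pathSum (suc m) 1 (F ∘ (D ∷_)) +ₚ pathSum (2 + m) 0 (F ∘ (R ∷_))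
    ≈⟨ +ₚ-cong (pathSum-∷ʳ m 0 (F ∘ (D ∷_))) (pathSum-∷ʳD (suc m) (F ∘ (R ∷_))) ⟩
  (DD +ₚ DR) +ₚ RD
    ≈⟨ +ₚ-right-comm DD DR RD ⟩
  (DD +ₚ RD) +ₚ DR
    ≈⟨ ≗ₚ-sym (+ₚ-congʳ DR (pathSum-∷ m 0 (F ∘ (_∷ʳ D)))) ⟩
  pathSum (suc m) 1 (F ∘ (_∷ʳ D)) +ₚ DR
    ≡⟨ cong (pathSum (suc m) 1 (F ∘ (_∷ʳ D)) +ₚ_) (≡.sym (pathSum-D∷ (suc m) (F ∘ (_∷ʳ R)))) ⟩
  pathSum (suc m) 1 (F ∘ (_∷ʳ D)) +ₚ pathSum (2 + m) 0 (F ∘ (_∷ʳ R))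
    ∎
  where
  DD = pathSum m 1 (F ∘ (D ∷_) ∘ (_∷ʳ D))
  DR = pathSum (suc m) 0 (F ∘ (D ∷_) ∘ (_∷ʳ R))
  RD = pathSum (suc m) 0 (F ∘ (R ∷_) ∘ (_∷ʳ D))
pathSum-∷ʳ zero (suc n) F = begin
  pathSum 1 (2 + n) F
    ≈⟨ pathSum-∷ 0 (suc n) F ⟩
  pathSum 0 (2 + n) (F ∘ (D ∷_)) +ₚ pathSum 1 (suc n) (F ∘ (R ∷_))
    ≈⟨ +ₚ-cong (pathSum-∷ʳR (suc n) (F ∘ (D ∷_))) (pathSum-∷ʳ 0 n (F ∘ (R ∷_))) ⟩
  DR +ₚ (RD +ₚ RR)
    ≈⟨ +ₚ-left-comm DR RD RR ⟩
  RD +ₚ (DR +ₚ RR)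
    ≈⟨ ≗ₚ-sym (+ₚ-congˡ RD (pathSum-∷ 0 n (F ∘ (_∷ʳ R)))) ⟩
  RD +ₚ pathSum 1 (suc n) (F ∘ (_∷ʳ R))
    ≡⟨ cong (_+ₚ pathSum 1 (suc n) (F ∘ (_∷ʳ R))) (≡.sym (pathSum-R∷ (suc n) (F ∘ (_∷ʳ D)))) ⟩
  pathSum 0 (2 + n) (F ∘ (_∷ʳ D)) +ₚ pathSum 1 (suc n) (F ∘ (_∷ʳ R))
    ∎
  where
  DR = pathSum 0 (suc n) (F ∘ (D ∷_) ∘ (_∷ʳ R))
  RD = pathSum 0 (suc n) (F ∘ (R ∷_) ∘ (_∷ʳ D))
  RR = pathSum 1 n (F ∘ (R ∷_) ∘ (_∷ʳ R))
pathSum-∷ʳ (suc m) (suc n) F = begin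
  pathSum (2 + m) (2 + n) F
    ≈⟨ pathSum-∷ (suc m) (suc n) F ⟩
  pathSum (suc m) (2 + n) (F ∘ (D ∷_)) +ₚ pathSum (2 + m) (suc n) (F ∘ (R ∷_))
    ≈⟨ +ₚ-cong (pathSum-∷ʳ m (suc n) (F ∘ (D ∷_))) (pathSum-∷ʳ (suc m) n (F ∘ (R ∷_))) ⟩
  (DD +ₚ DR) +ₚ (RD +ₚ RR)
    ≈⟨ +ₚ-interchange DD DR RD RR ⟩
  (DD +ₚ RD) +ₚ (DR +ₚ RR)
    ≈⟨ ≗ₚ-sym (+ₚ-cong (pathSum-∷ m (suc n) (F ∘ (_∷ʳ D))) (pathSum-∷ (suc m) n (F ∘ (_∷ʳ R)))) ⟩
  pathSum (suc m) (2 + n) (F ∘ (_∷ʳ D)) +ₚ pathSum (2 + m) (suc n) (F ∘ (_∷ʳ R))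
    ∎
  where
  DD = pathSum m (2 + n) (F ∘ (D ∷_) ∘ (_∷ʳ D))
  DR = pathSum (suc m) (suc n) (F ∘ (D ∷_) ∘ (_∷ʳ R))
  RD = pathSum (suc m) (suc n) (F ∘ (R ∷_) ∘ (_∷ʳ D))
  RR = pathSum (2 + m) n (F ∘ (R ∷_) ∘ (_∷ʳ R))

advance : ℕ × ℕ → Step → ℕ × ℕ
advance (i , j) D = suc i , j
advance (i , j) R = i , suc j

endpoint : Path → ℕ × ℕ
endpoint = foldl advance (0 , 0)

endpoint-∷ʳ : ∀ p {m n} t → endpoint p ≡ (m , n) → endpoint (p ∷ʳ t) ≡ advance (m , n) t
endpoint-∷ʳ p t e = ≡.trans (foldl-∷ʳ advance (0 , 0) t p) (cong (λ x → advance x t) e)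

pathSum-cong : ∀ m n {F G} → (∀ p → endpoint p ≡ (m , n) → F p ≗ₚ G p) →
  pathSum m n F ≗ₚ pathSum m n G
pathSum-cong zero zero h = +ₚ-congʳ 0ₚ (h [] refl)
pathSum-cong (suc m) zero {F} {G} h = begin
  pathSum (suc m) 0 F         ≈⟨ pathSum-∷ʳD m F ⟩
  pathSum m 0 (F ∘ (_∷ʳ D))   ≈⟨ pathSum-cong m 0 (λ p e → h (p ∷ʳ D) (endpoint-∷ʳ p D e)) ⟩
  pathSum m 0 (G ∘ (_∷ʳ D))   ≈⟨ ≗ₚ-sym (pathSum-∷ʳD m G) ⟩
  pathSum (suc m) 0 G         ∎
pathSum-cong zero (suc n) {F} {G} h = begin
  pathSum 0 (suc n) F         ≈⟨ pathSum-∷ʳR n F ⟩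
  pathSum 0 n (F ∘ (_∷ʳ R))   ≈⟨ pathSum-cong 0 n (λ p e → h (p ∷ʳ R) (endpoint-∷ʳ p R e)) ⟩
  pathSum 0 n (G ∘ (_∷ʳ R))   ≈⟨ ≗ₚ-sym (pathSum-∷ʳR n G) ⟩
  pathSum 0 (suc n) G         ∎
pathSum-cong (suc m) (suc n) {F} {G} h = begin
  pathSum (suc m) (suc n) F
    ≈⟨ pathSum-∷ʳ m n F ⟩
  pathSum m (suc n) (F ∘ (_∷ʳ D)) +ₚ pathSum (suc m) n (F ∘ (_∷ʳ R))
    ≈⟨ +ₚ-cong (pathSum-cong m (suc n) (λ p e → h (p ∷ʳ D) (endpoint-∷ʳ p D e)))
               (pathSum-cong (suc m) n (λ p e → h (p ∷ʳ R) (endpoint-∷ʳ p R e))) ⟩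
  pathSum m (suc n) (G ∘ (_∷ʳ D)) +ₚ pathSum (suc m) n (G ∘ (_∷ʳ R))
    ≈⟨ ≗ₚ-sym (pathSum-∷ʳ m n G) ⟩
  pathSum (suc m) (suc n) G
    ∎

-- Marked sums and the scored walk

mark : Bool → ℕ → ℕ
mark b x = if b then x else 0

markedSum : ℕ → (ℕ → Bool) → ℕ → ℕ
markedSum off f zero    = 0
markedSum off f (suc k) = markedSum off f k + mark (f k) (off + k)

markedSum-front : ∀ off f k →
  markedSum off f (suc k) ≡ mark (f 0) off + markedSum (suc off) (f ∘ suc) k
markedSum-front off f zero =
  ≡.trans (cong (mark (f 0)) (+-identityʳ off)) (≡.sym (+-identityʳ (mark (f 0) off)))
markedSum-front off f (suc k) =
  ≡.trans (cong (_+ mark (f (suc k)) (off + suc k)) (markedSum-front off f k))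
   (≡.trans (+-assoc (mark (f 0) off) (markedSum (suc off) (f ∘ suc) k) _)
     (cong (λ x → mark (f 0) off + (markedSum (suc off) (f ∘ suc) k + mark (f (suc k)) x)) (+-suc off k)))

sumFrom≡markedSum : ∀ {k} off (S : Subset k) → sumFrom off S ≡ markedSum off (memb S) k
sumFrom≡markedSum off []                = refl
sumFrom≡markedSum {suc k} off (b ∷ bs) =
  ≡.trans (cong (mark b off +_) (sumFrom≡markedSum (suc off) bs))
          (≡.sym (markedSum-front off (memb (b ∷ bs)) k))

markedSum-none : ∀ off k → markedSum off (λ _ → false) k ≡ 0
markedSum-none off zero    = refl
markedSum-none off (suc k) = ≡.trans (+-identityʳ _) (markedSum-none off k)

module Scored (inH inV : ℕ → Bool) where

  score : Bool → ℕ × ℕ → Step → ℕ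
  score enteredByR (i , j) next = here inH inV enteredByR i j (next ∷ [])

  walkThen : Bool → ℕ → ℕ → Path → Step → ℕ
  walkThen b i j []       s = here inH inV b i j (s ∷ [])
  walkThen b i j (R ∷ ss) s = here inH inV b i j (R ∷ ss) + walkThen true i (suc j) ss s
  walkThen b i j (D ∷ ss) s = here inH inV b i j (D ∷ ss) + walkThen false (suc i) j ss s

  walk≡walkThen : ∀ b i j p → walk inH inV b i j p ≡ walkThen b i j p R
  walk≡walkThen b i j []       = refl
  walk≡walkThen b i j (R ∷ ss) = cong (here inH inV b i j (R ∷ ss) +_) (walk≡walkThen true i (suc j) ss)
  walk≡walkThen b i j (D ∷ ss) = cong (here inH inV b i j (D ∷ ss) +_) (walk≡walkThen false (suc i) j ss)

  walkThen-∷ʳ : ∀ b i j p t s →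
    walkThen b i j (p ∷ʳ t) s ≡ walkThen b i j p t + score (isR t) (foldl advance (i , j) (p ∷ʳ t)) s
  walkThen-∷ʳ b i j []       R s = refl
  walkThen-∷ʳ b i j []       D s = refl
  walkThen-∷ʳ b i j (R ∷ ss) t s =
    ≡.trans (cong (here inH inV b i j (R ∷ ss) +_) (walkThen-∷ʳ true i (suc j) ss t s))
            (≡.sym (+-assoc (here inH inV b i j (R ∷ ss)) _ _))
  walkThen-∷ʳ b i j (D ∷ ss) t s =
    ≡.trans (cong (here inH inV b i j (D ∷ ss) +_) (walkThen-∷ʳ false (suc i) j ss t s))
            (≡.sym (+-assoc (here inH inV b i j (D ∷ ss)) _ _))

  cindexThen : Step → Path → ℕ
  cindexThen s p = walkThen false 0 0 p s

  genPolyThen : Step → ℕ → ℕ → Poly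
  genPolyThen s m n = genPoly m n (cindexThen s)

  pathSum-cindexThen-∷ʳ : ∀ m n t s →
    pathSum m n (λ p → mono (cindexThen s (p ∷ʳ t)))
      ≗ₚ shift (score (isR t) (advance (m , n) t) s) (genPolyThen t m n)
  pathSum-cindexThen-∷ʳ m n t s = begin
    pathSum m n (λ p → mono (cindexThen s (p ∷ʳ t)))  ≈⟨ pathSum-cong m n last-node ⟩
    pathSum m n (shift w ∘ mono ∘ cindexThen t)        ≈⟨ sumOver-shift w (paths m n) (mono ∘ cindexThen t) ⟩
    shift w (genPolyThen t m n)                        ∎
    where
    w = score (isR t) (advance (m , n) t) s
    last-node : ∀ p → endpoint p ≡ (m , n) → mono (cindexThen s (p ∷ʳ t)) ≗ₚ shift w (mono (cindexThen t p))
    last-node p e = begin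
      mono (cindexThen s (p ∷ʳ t))
        ≡⟨ cong mono (walkThen-∷ʳ false 0 0 p t s) ⟩
      mono (cindexThen t p + score (isR t) (endpoint (p ∷ʳ t)) s)
        ≡⟨ cong (λ q → mono (cindexThen t p + score (isR t) q s)) (endpoint-∷ʳ p t e) ⟩
      mono (cindexThen t p + w)
        ≡⟨ cong mono (+-comm (cindexThen t p) w) ⟩
      mono (w + cindexThen t p)
        ≈⟨ ≗ₚ-sym (shift-mono w (cindexThen t p)) ⟩
      shift w (mono (cindexThen t p))
        ∎

  genPolyThen-∷ʳ : ∀ s m n →
    genPolyThen s (suc m) (suc n)
      ≗ₚ (shift (score false (suc m , suc n) s) (genPolyThen D m (suc n))
           +ₚ shift (score true (suc m , suc n) s) (genPolyThen R (suc m) n))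
  genPolyThen-∷ʳ s m n =
    ≗ₚ-trans (pathSum-∷ʳ m n (mono ∘ cindexThen s))
             (+ₚ-cong (pathSum-cindexThen-∷ʳ m (suc n) D s) (pathSum-cindexThen-∷ʳ (suc m) n R s))

  genPolyThen-∷ʳD : ∀ s m → genPolyThen s (suc m) 0 ≗ₚ shift (score false (suc m , 0) s) (genPolyThen D m 0)
  genPolyThen-∷ʳD s m = ≗ₚ-trans (pathSum-∷ʳD m (mono ∘ cindexThen s)) (pathSum-cindexThen-∷ʳ m 0 D s)

  genPolyThen-∷ʳR : ∀ s n → genPolyThen s 0 (suc n) ≗ₚ shift (score true (0 , suc n) s) (genPolyThen R 0 n)
  genPolyThen-∷ʳR s n = ≗ₚ-trans (pathSum-∷ʳR n (mono ∘ cindexThen s)) (pathSum-cindexThen-∷ʳ 0 n R s)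

  σH σV : ℕ → ℕ
  σH = markedSum 0 inH
  σV = markedSum 1 (inV ∘ suc)

  -- A following D-step adds row m (if marked) and column n (marked or not) to the exponent.
  closedForm : Step → ℕ → ℕ → Poly
  closedForm R m n       = shift (σH m) (shift (σV n) (gaussBox m n))
  closedForm D m zero    = shift (σH (suc m)) (gaussBox m zero)
  closedForm D m (suc n) = shift (σH (suc m)) (shift (σV n) (shift (suc n) (gaussBox m (suc n))))

  corner-pascal-R : ∀ m n →
    (shift (score false (suc m , suc n) R) (shift (suc n) (gaussBox m (suc n)))
      +ₚ shift (score true (suc m , suc n) R) (gaussBox (suc m) n))
      ≗ₚ shift (mark (inV (suc n)) (suc n)) (gaussBox (suc m) (suc n))
  corner-pascal-R m n with inV (suc n)
  ... | true  = gaussBox-pascal-shifted m n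
  ... | false = ≗ₚ-sym (gaussBox-pascal′ m n)

  corner-pascal-D : ∀ m n →
    (shift (score false (suc m , suc n) D) (shift (suc n) (gaussBox m (suc n)))
      +ₚ shift (score true (suc m , suc n) D) (gaussBox (suc m) n))
      ≗ₚ shift (mark (inH (suc m)) (suc m)) (shift (suc n) (gaussBox (suc m) (suc n)))
  corner-pascal-D m n with inH (suc m)
  ... | false = gaussBox-pascal-shifted m n
  ... | true  = begin
    shift N (shift (suc n) (gaussBox m (suc n))) +ₚ shift N (gaussBox (suc m) n)
      ≈⟨ ≗ₚ-sym (shift-+ₚ N (shift (suc n) (gaussBox m (suc n))) (gaussBox (suc m) n)) ⟩
    shift N (shift (suc n) (gaussBox m (suc n)) +ₚ gaussBox (suc m) n)
      ≈⟨ shift-cong N (≗ₚ-sym (gaussBox-pascal′ m n)) ⟩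
    shift N (gaussBox (suc m) (suc n))
      ≈⟨ ≗ₚ-sym (shift-shift (suc m) (suc n) (gaussBox (suc m) (suc n))) ⟩
    shift (suc m) (shift (suc n) (gaussBox (suc m) (suc n)))
      ∎
    where N = suc m + suc n

  closedForm-∷ʳ : ∀ s m n →
    (shift (score false (suc m , suc n) s) (closedForm D m (suc n))
      +ₚ shift (score true (suc m , suc n) s) (closedForm R (suc m) n))
      ≗ₚ closedForm s (suc m) (suc n)
  closedForm-∷ʳ R m n = begin
    shift wD (shift a (shift v (shift (suc n) G₁))) +ₚ shift wR (shift a (shift v G₂))
      ≈⟨ shift₂-+ₚ a v wD wR (shift (suc n) G₁) G₂ ⟩
    shift a (shift v (shift wD (shift (suc n) G₁) +ₚ shift wR G₂))
      ≈⟨ shift-cong a (shift-cong v (corner-pascal-R m n)) ⟩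
    shift a (shift v (shift (mark (inV (suc n)) (suc n)) G))
      ≈⟨ shift-cong a (shift-shift v (mark (inV (suc n)) (suc n)) G) ⟩
    closedForm R (suc m) (suc n)
      ∎
    where
    a = σH (suc m); v = σV n
    wD = score false (suc m , suc n) R; wR = score true (suc m , suc n) R
    G₁ = gaussBox m (suc n); G₂ = gaussBox (suc m) n; G = gaussBox (suc m) (suc n)
  closedForm-∷ʳ D m n = begin
    shift wD (shift a (shift v (shift (suc n) G₁))) +ₚ shift wR (shift a (shift v G₂))
      ≈⟨ shift₂-+ₚ a v wD wR (shift (suc n) G₁) G₂ ⟩
    shift a (shift v (shift wD (shift (suc n) G₁) +ₚ shift wR G₂))
      ≈⟨ shift-cong a (shift-cong v (corner-pascal-D m n)) ⟩
    shift a (shift v (shift h (shift (suc n) G)))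
      ≈⟨ shift-cong a (shift-comm v h (shift (suc n) G)) ⟩
    shift a (shift h (shift v (shift (suc n) G)))
      ≈⟨ shift-shift a h (shift v (shift (suc n) G)) ⟩
    closedForm D (suc m) (suc n)
      ∎
    where
    a = σH (suc m); v = σV n; h = mark (inH (suc m)) (suc m)
    wD = score false (suc m , suc n) D; wR = score true (suc m , suc n) D
    G₁ = gaussBox m (suc n); G₂ = gaussBox (suc m) n; G = gaussBox (suc m) (suc n)

  closedForm-∷ʳD : ∀ s m → shift (score false (suc m , 0) s) (closedForm D m 0) ≗ₚ closedForm s (suc m) 0
  closedForm-∷ʳD R m = shift-cong (σH (suc m)) (gaussBox-zeroʳ-const m (suc m))
  closedForm-∷ʳD D m = begin
    shift w (shift a (gaussBox m 0))        ≈⟨ shift-comm w a (gaussBox m 0) ⟩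
    shift a (shift w (gaussBox m 0))        ≈⟨ shift-cong a (step-down (inH (suc m))) ⟩
    shift a (shift h (gaussBox (suc m) 0))  ≈⟨ shift-shift a h (gaussBox (suc m) 0) ⟩
    closedForm D (suc m) 0                  ∎
    where
    a = σH (suc m); h = mark (inH (suc m)) (suc m); w = score false (suc m , 0) D
    step-down : ∀ b →
      shift (mark (b ∨ false) (suc m + 0)) (gaussBox m 0) ≗ₚ shift (mark b (suc m)) (gaussBox (suc m) 0)
    step-down true  = shift-cong₂ (+-identityʳ (suc m)) (gaussBox-zeroʳ-const m (suc m))
    step-down false = gaussBox-zeroʳ-const m (suc m)

  closedForm-∷ʳR : ∀ s n → shift (score true (0 , suc n) s) (closedForm R 0 n) ≗ₚ closedForm s 0 (suc n)
  closedForm-∷ʳR R n =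
    ≗ₚ-trans (shift-comm (mark (inV (suc n)) (suc n)) (σV n) (mono 0))
             (shift-shift (σV n) (mark (inV (suc n)) (suc n)) (mono 0))
  closedForm-∷ʳR D n with inH 0
  ... | true  = shift-comm (suc n) (σV n) (mono 0)
  ... | false = shift-comm (suc n) (σV n) (mono 0)

  genPolyThen-closedForm : ∀ s m n → genPolyThen s m n ≗ₚ closedForm s m n
  genPolyThen-closedForm R zero zero k = +-identityʳ _
  genPolyThen-closedForm D zero zero k with inH 0
  ... | true  = +-identityʳ _
  ... | false = +-identityʳ _
  genPolyThen-closedForm s (suc m) zero = begin
    genPolyThen s (suc m) 0      ≈⟨ genPolyThen-∷ʳD s m ⟩
    shift w (genPolyThen D m 0)  ≈⟨ shift-cong w (genPolyThen-closedForm D m 0) ⟩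
    shift w (closedForm D m 0)   ≈⟨ closedForm-∷ʳD s m ⟩
    closedForm s (suc m) 0       ∎
    where w = score false (suc m , 0) s
  genPolyThen-closedForm s zero (suc n) = begin
    genPolyThen s 0 (suc n)      ≈⟨ genPolyThen-∷ʳR s n ⟩
    shift w (genPolyThen R 0 n)  ≈⟨ shift-cong w (genPolyThen-closedForm R 0 n) ⟩
    shift w (closedForm R 0 n)   ≈⟨ closedForm-∷ʳR s n ⟩
    closedForm s 0 (suc n)       ∎
    where w = score true (0 , suc n) s
  genPolyThen-closedForm s (suc m) (suc n) = begin
    genPolyThen s (suc m) (suc n)
      ≈⟨ genPolyThen-∷ʳ s m n ⟩
    shift wD (genPolyThen D m (suc n)) +ₚ shift wR (genPolyThen R (suc m) n)
      ≈⟨ +ₚ-cong (shift-cong wD (genPolyThen-closedForm D m (suc n)))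
                 (shift-cong wR (genPolyThen-closedForm R (suc m) n)) ⟩
    shift wD (closedForm D m (suc n)) +ₚ shift wR (closedForm R (suc m) n)
      ≈⟨ closedForm-∷ʳ s m n ⟩
    closedForm s (suc m) (suc n)
      ∎
    where
    wD = score false (suc m , suc n) s
    wR = score true (suc m , suc n) s

  genPoly-cindexWith : ∀ m n →
    genPoly m n (cindexWith inH inV) ≗ₚ shift (σH m + σV n) (gaussBox m n)
  genPoly-cindexWith m n = begin
    genPoly m n (cindexWith inH inV)
      ≈⟨ pathSum-cong m n (λ p _ k → cong (λ x → mono x k) (walk≡walkThen false 0 0 p)) ⟩
    genPolyThen R m n
      ≈⟨ genPolyThen-closedForm R m n ⟩
    shift (σH m) (shift (σV n) (gaussBox m n))
      ≈⟨ shift-shift (σH m) (σV n) (gaussBox m n) ⟩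
    shift (σH m + σV n) (gaussBox m n)
      ∎

corollary2 : (m n : ℕ) (H : Subset m) (V : Subset n) →
    (genPoly m n (CINDEXHV H V) ≗ₚ shift (shiftSum H V) (gauss (m + n) m))
    × (shift (shiftSum H V) (gauss (m + n) m) ≗ₚ shift (shiftSum H V) (genPoly m n CINDEX))
corollary2 m n H V = scrambled , shift-cong (shiftSum H V) (≗ₚ-sym unscrambled)
  where
  scrambled : genPoly m n (CINDEXHV H V) ≗ₚ shift (shiftSum H V) (gaussBox m n)
  scrambled = ≗ₚ-trans (Scored.genPoly-cindexWith (inRows H) (inCols V) m n)
    (shift-cong₂ (cong₂ _+_ (≡.sym (sumFrom≡markedSum 0 H)) (≡.sym (sumFrom≡markedSum 1 V)))
                 (≗ₚ-refl {gaussBox m n}))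
  unscrambled : genPoly m n CINDEX ≗ₚ gaussBox m n
  unscrambled = ≗ₚ-trans (Scored.genPoly-cindexWith (λ _ → false) (λ _ → false) m n)
    (shift-cong₂ (cong₂ _+_ (markedSum-none 0 m) (markedSum-none 1 n)) (≗ₚ-refl {gaussBox m n}))
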